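{- Let $w\geq 4$ be an integer and let $C_2(w)=\{(x,y)\in\mathbb{R}^2: (x+y-1)^2=wxy\}$. A point $(x,y)\in C_2(w)$ has positive integer coordinates if and only if $(x,y)=(u_{n+1}(w),u_n(w))$ or $(x,y)=(u_n(w),u_{n+1}(w))$ for some integer $n\geq 1$.
   Context: The sequence $(u_n(w))_{n\geq0}$ is defined by $u_0(w)=0$, $u_1(w)=1$, and $u_{n+1}(w)=(w-2)u_n(w)-u_{n-1}(w)+2$ for $n\geq 1$ (so $u_2(w)=w$). -}

module Defs where

open import Data.Nat using (ℕ; zero; suc)
open import Data.Integer using (ℤ; +_; _+_; _-_; _*_)

u : ℕ → ℤ → ℤ
u zero w = + 0
u (suc zero) w = + 1
u (suc (suc n)) w = (w - + 2) * u (suc n) w - u n w + + 2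

OnC2 : ℤ → ℤ → ℤ → Set
OnC2 w x y = (x + y - + 1) * (x + y - + 1) ≡ w * x * y
  where open import Relation.Binary.PropositionalEquality using (_≡_)

module Submission where

-- Vieta jumping on the curve  C₂(W) : (x + y - 1)² = W x y.
--
-- For fixed second coordinate X, the first coordinates t of points (t, X)
-- on C₂(W) are the roots of  t² + (2(X - 1) - W X) t + (X - 1)² = 0,  so
-- with one root Y the other is  jump W X Y = (W - 2) X - Y + 2,  and the
-- product of the roots is (X - 1)².  The recurrence defining u is exactly
-- this jump, so (u (n+1), u n) lies on the curve for every n (soundness).
--
-- Conversely, let (a, b) be a positive point with a > b.  If b = 1 the
-- equation forces a = W = u 2.  If b ≥ 2, jumping gives the point (b, c)
-- with a c = (b - 1)², hence 1 ≤ c < b, and strong induction on b shows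
-- that (b, c), and then (a, b), are consecutive terms (u (n+1), u n).
-- Points with a = b do not exist when W ≥ 4, since (2x - 1)² < 4x² ≤ W x²;
-- the remaining case a < b follows from the symmetry of the curve.

open import Defs
open import Data.Nat using (ℕ; _≤_; _<_)
open import Data.Integer using (ℤ; +_)
open import Data.Product using (_×_; ∃-syntax)
open import Data.Sum using (_⊎_)
open import Relation.Binary.PropositionalEquality using (_≡_)
open import Function.Bundles using (_⇔_)

open import Data.Nat as ℕ using (zero; suc; z≤n; s≤s)
import Data.Nat.Properties as ℕP
open import Data.Nat.Induction using (<-rec)
open import Data.Integer as ℤ using (-[1+_]; _-_; NonZero)
import Data.Integer.Properties as ℤP
open import Data.Integer.Tactic.RingSolver using (solve-∀)
open import Data.Product using (_,_)
open import Data.Sum using (inj₁; inj₂)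
open import Data.Empty using (⊥-elim)
open import Relation.Nullary using (¬_; yes; no)
open import Relation.Binary.PropositionalEquality
  using (refl; sym; trans; cong; cong₂; subst; subst₂; module ≡-Reasoning)
open import Relation.Binary.Definitions using (tri<; tri≈; tri>)
open import Function.Bundles using (mk⇔)

open ≡-Reasoning

-- The Vieta jump: the second root t of (t + X - 1)² = W t X besides t = Y.
jump : ℤ → ℤ → ℤ → ℤ
jump W X Y = (W - + 2) ℤ.* X - Y ℤ.+ + 2

u-jump : ∀ W n → u (suc (suc n)) W ≡ jump W (u (suc n) W) (u n W)
u-jump W n = refl

jump-involutive : ∀ W X Y → jump W X (jump W X Y) ≡ Y
jump-involutive = polynomial
  where
  polynomial : ∀ W X Y → (W - + 2) ℤ.* X - ((W - + 2) ℤ.* X - Y ℤ.+ + 2) ℤ.+ + 2 ≡ Y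
  polynomial = solve-∀

-- An identity P = A + (L - R) reduces to P = A wherever L = R; this is how
-- polynomial identities are specialised to points of the curve.
collapse : ∀ {P A L R : ℤ} → P ≡ A ℤ.+ (L - R) → L ≡ R → P ≡ A
collapse {P} {A} {L} {R} identity L≡R = begin
  P              ≡⟨ identity ⟩
  A ℤ.+ (L - R)  ≡⟨ cong (λ l → A ℤ.+ (l - R)) L≡R ⟩
  A ℤ.+ (R - R)  ≡⟨ cong (λ e → A ℤ.+ e) (ℤP.+-inverseʳ R) ⟩
  A ℤ.+ + 0      ≡⟨ ℤP.+-identityʳ A ⟩
  A              ∎

onC2-swap : ∀ W X Y → OnC2 W X Y → OnC2 W Y X
onC2-swap W X Y onC = trans (square-swap X Y) (trans onC (product-swap W X Y))
  where
  square-swap : ∀ X Y → (Y ℤ.+ X - + 1) ℤ.* (Y ℤ.+ X - + 1) ≡ (X ℤ.+ Y - + 1) ℤ.* (X ℤ.+ Y - + 1)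
  square-swap = solve-∀
  product-swap : ∀ W X Y → W ℤ.* X ℤ.* Y ≡ W ℤ.* Y ℤ.* X
  product-swap = solve-∀

onC2-jump : ∀ W X Y → OnC2 W X Y → OnC2 W (jump W X Y) X
onC2-jump W X Y onC = collapse (polynomial W X Y) onC
  where
  polynomial : ∀ W X Y →
    let Z = (W - + 2) ℤ.* X - Y ℤ.+ + 2 in
    (Z ℤ.+ X - + 1) ℤ.* (Z ℤ.+ X - + 1)
      ≡ W ℤ.* Z ℤ.* X ℤ.+ ((X ℤ.+ Y - + 1) ℤ.* (X ℤ.+ Y - + 1) - W ℤ.* X ℤ.* Y)
  polynomial = solve-∀

jump-product : ∀ W X Y → OnC2 W Y X → Y ℤ.* jump W X Y ≡ (X - + 1) ℤ.* (X - + 1)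
jump-product W X Y onC = collapse (polynomial W X Y) (sym onC)
  where
  polynomial : ∀ W X Y →
    Y ℤ.* ((W - + 2) ℤ.* X - Y ℤ.+ + 2)
      ≡ (X - + 1) ℤ.* (X - + 1) ℤ.+ (W ℤ.* Y ℤ.* X - (Y ℤ.+ X - + 1) ℤ.* (Y ℤ.+ X - + 1))
  polynomial = solve-∀

u-onC2 : ∀ W n → OnC2 W (u (suc n) W) (u n W)
u-onC2 W zero = sym (ℤP.*-zeroʳ (W ℤ.* + 1))
u-onC2 W (suc n) = onC2-jump W (u (suc n) W) (u n W) (u-onC2 W n)

onC2-second-one : ∀ W X .{{_ : NonZero X}} → OnC2 W X (+ 1) → X ≡ u 2 W
onC2-second-one W X onC = begin
  X          ≡⟨ ℤP.*-cancelʳ-≡ X W X (trans (square X) (trans onC (times-one W X))) ⟩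
  W          ≡⟨ u₂ W ⟩
  u 2 W      ∎
  where
  square : ∀ X → X ℤ.* X ≡ (X ℤ.+ + 1 - + 1) ℤ.* (X ℤ.+ + 1 - + 1)
  square = solve-∀
  times-one : ∀ W X → W ℤ.* X ℤ.* + 1 ≡ W ℤ.* X
  times-one = solve-∀
  u₂ : ∀ W → W ≡ (W - + 2) ℤ.* + 1 - + 0 ℤ.+ + 2
  u₂ = solve-∀

-- For w ≥ 4 the curve has no positive point on the diagonal: writing
-- w = 4 + d and x = 1 + t,  w x² - (2x - 1)² = 3 + 4t + d x² > 0.
no-diagonal : ∀ w → 4 ≤ w → ∀ x → 0 < x → ¬ OnC2 (+ w) (+ x) (+ x)
no-diagonal (suc (suc (suc (suc d)))) (s≤s (s≤s (s≤s (s≤s z≤n)))) (suc t) _ onC = gap≢0 gap≡0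
  where
  x = suc t
  gap : ℕ
  gap = 3 ℕ.+ (4 ℕ.* t ℕ.+ d ℕ.* x ℕ.* x)
  gap≢0 : ¬ + gap ≡ + 0
  gap≢0 ()
  gap-cast : + gap ≡ + 3 ℤ.+ (+ 4 ℤ.* + t ℤ.+ + d ℤ.* + x ℤ.* + x)
  gap-cast = begin
    + gap                                          ≡⟨ ℤP.pos-+ 3 _ ⟩
    + 3 ℤ.+ + (4 ℕ.* t ℕ.+ d ℕ.* x ℕ.* x)          ≡⟨ cong (λ e → + 3 ℤ.+ e) (ℤP.pos-+ (4 ℕ.* t) _) ⟩
    + 3 ℤ.+ (+ (4 ℕ.* t) ℤ.+ + (d ℕ.* x ℕ.* x))    ≡⟨ cong₂ (λ e f → + 3 ℤ.+ (e ℤ.+ f)) (ℤP.pos-* 4 t)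
                                                          (trans (ℤP.pos-* (d ℕ.* x) x)
                                                                 (cong (λ e → e ℤ.* + x) (ℤP.pos-* d x))) ⟩
    + 3 ℤ.+ (+ 4 ℤ.* + t ℤ.+ + d ℤ.* + x ℤ.* + x)  ∎
  polynomial : ∀ D T → let X = + 1 ℤ.+ T in
    + 3 ℤ.+ (+ 4 ℤ.* T ℤ.+ D ℤ.* X ℤ.* X)
      ≡ + 0 ℤ.+ ((+ 4 ℤ.+ D) ℤ.* X ℤ.* X - (X ℤ.+ X - + 1) ℤ.* (X ℤ.+ X - + 1))
  polynomial = solve-∀
  gap≡0 : + gap ≡ + 0
  gap≡0 = trans gap-cast (collapse (polynomial (+ d) (+ t)) (sym onC))

positive-cofactor : ∀ {a k} (c : ℤ) → + suc a ℤ.* c ≡ + suc k → ∃[ m ] c ≡ + suc m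
positive-cofactor {a} (+ zero) product with trans (sym (ℤP.*-zeroʳ (+ suc a))) product
... | ()
positive-cofactor (+ suc m) _ = m , refl
positive-cofactor -[1+ _ ] ()

cofactor-bound : ∀ {a c m} → m < a → a ℕ.* c ≡ m ℕ.* m → c ≤ m
cofactor-bound {c = c} {m = m} m<a product with c ℕ.≤? m
... | yes c≤m = c≤m
... | no c≰m = ⊥-elim (ℕP.<⇒≢ (ℕP.*-mono-< m<a (ℕP.≰⇒> c≰m)) (sym product))

-- The descent step: jumping a point (a, b) with a > b ≥ 2 yields a point
-- (b, c) with 1 ≤ c < b, because a c = (b - 1)² and a > b - 1.  (For
-- b = 2 + b', the integer (b - 1)² computes to the natural number (1 + b')².)
jump-descends : ∀ W a b → 2 ≤ b → b < a → OnC2 W (+ a) (+ b) →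
  ∃[ c ] (1 ≤ c × c < b × jump W (+ b) (+ a) ≡ + c)
jump-descends W (suc a') (suc (suc b')) (s≤s (s≤s z≤n)) b<a onC
  with positive-cofactor {a'} (jump W (+ suc (suc b')) (+ suc a'))
                              (jump-product W (+ suc (suc b')) (+ suc a') onC)
... | c' , jump≡c = suc c' , s≤s z≤n , s≤s (cofactor-bound b-1<a product) , jump≡c
  where
  b-1<a : suc b' < suc a'
  b-1<a = ℕP.<-trans (ℕP.n<1+n (suc b')) b<a
  product : suc a' ℕ.* suc c' ≡ suc b' ℕ.* suc b'
  product = ℤP.+-injective (trans (cong (λ e → + suc a' ℤ.* e) (sym jump≡c))
                                       (jump-product W (+ suc (suc b')) (+ suc a') onC))

Consecutive : ℤ → ℕ → ℕ → Set
Consecutive W a b = ∃[ n ] (1 ≤ n × + a ≡ u (suc n) W × + b ≡ u n W)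

extend : ∀ W {a b c} → Consecutive W b c → jump W (+ b) (+ a) ≡ + c → Consecutive W a b
extend W {a} {b} {c} (n , _ , b≡u , c≡u) jump≡c = suc n , s≤s z≤n , a≡u , b≡u
  where
  a≡u : + a ≡ u (suc (suc n)) W
  a≡u = begin
    + a                                ≡⟨ sym (jump-involutive W (+ b) (+ a)) ⟩
    jump W (+ b) (jump W (+ b) (+ a))  ≡⟨ cong₂ (jump W) b≡u (trans jump≡c c≡u) ⟩
    jump W (u (suc n) W) (u n W)       ≡⟨ sym (u-jump W n) ⟩
    u (suc (suc n)) W                  ∎

descent : ∀ W b → 1 ≤ b → ∀ a → b < a → OnC2 W (+ a) (+ b) → Consecutive W a b
descent W = <-rec P step
  where
  P : ℕ → Set
  P b = 1 ≤ b → ∀ a → b < a → OnC2 W (+ a) (+ b) → Consecutive W a b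
  step : ∀ b → (∀ {c} → c < b → P c) → P b
  step zero _ ()
  step (suc zero) _ _ zero ()
  step (suc zero) _ _ (suc a') _ onC = 1 , s≤s z≤n , onC2-second-one W (+ suc a') onC , refl
  step b@(suc (suc _)) descend _ a b<a onC with jump-descends W a b (s≤s (s≤s z≤n)) b<a onC
  ... | c , 1≤c , c<b , jump≡c = extend W (descend c<b 1≤c b c<b jumped) jump≡c
    where
    jumped : OnC2 W (+ b) (+ c)
    jumped = subst (OnC2 W (+ b)) jump≡c
               (onC2-swap W _ _ (onC2-jump W (+ b) (+ a) (onC2-swap W (+ a) (+ b) onC)))

ConsecutiveEitherOrder : ℤ → ℕ → ℕ → Set
ConsecutiveEitherOrder W x y =
  ∃[ n ] (1 ≤ n × ((+ x ≡ u (suc n) W × + y ≡ u n W) ⊎ (+ x ≡ u n W × + y ≡ u (suc n) W)))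

generate : ∀ W x y → ConsecutiveEitherOrder W x y → OnC2 W (+ x) (+ y)
generate W x y (n , _ , inj₁ (x≡u , y≡u)) = subst₂ (OnC2 W) (sym x≡u) (sym y≡u) (u-onC2 W n)
generate W x y (n , _ , inj₂ (x≡u , y≡u)) =
  subst₂ (OnC2 W) (sym x≡u) (sym y≡u) (onC2-swap W _ _ (u-onC2 W n))

classify : ∀ w → 4 ≤ w → ∀ x y → 0 < x → 0 < y → OnC2 (+ w) (+ x) (+ y) →
  ConsecutiveEitherOrder (+ w) x y
classify w 4≤w x y 0<x 0<y onC with ℕP.<-cmp x y
... | tri< x<y _ _ with descent (+ w) x 0<x y x<y (onC2-swap (+ w) (+ x) (+ y) onC)
...   | n , 1≤n , y≡u , x≡u = n , 1≤n , inj₂ (x≡u , y≡u)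
classify w 4≤w x y 0<x 0<y onC | tri≈ _ refl _ = ⊥-elim (no-diagonal w 4≤w x 0<x onC)
classify w 4≤w x y 0<x 0<y onC | tri> _ _ y<x with descent (+ w) y 0<y x y<x onC
...   | n , 1≤n , x≡u , y≡u = n , 1≤n , inj₁ (x≡u , y≡u)

theorem2 : (w : ℕ) → 4 ≤ w → (x y : ℕ) → 0 < x → 0 < y →
    (OnC2 (+ w) (+ x) (+ y) ⇔
      (∃[ n ] (1 ≤ n × (((+ x ≡ u (ℕ.suc n) (+ w)) × (+ y ≡ u n (+ w)))
                        ⊎ ((+ x ≡ u n (+ w)) × (+ y ≡ u (ℕ.suc n) (+ w)))))))
theorem2 w 4≤w x y 0<x 0<y =
  mk⇔ (classify w 4≤w x y 0<x 0<y) (generate (+ w) x y)
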